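{- Let $S_1,\dots,S_j$ be Skolem-type sequences, and let $X_i$ be the set of symbols occurring in $S_i$. Suppose $\bigcup_{i=1}^j X_i=\{1,2,\dots,m\}$ and the sets $X_1,\dots,X_j$ are pairwise disjoint. Then the concatenation $S_1S_2\cdots S_j$ (a sequence of length $2m$), written around the cycle $C_{2m}$ (its $k$-th entry placed on vertex $v_k$), is a $j$-edge-removable Skolem circle of order $m$.
   Context: A Skolem-type sequence with symbol set $D$ (a finite set of positive integers, $|D|=n$) is a sequence $(s_1,\dots,s_{2n})$ with entries in $D$ in which each $i\in D$ occurs exactly twice, at positions $p<q$ with $q-p=i$. Let $C_{2m}$ be the cycle graph with vertices $v_1,\dots,v_{2m}$ in cyclic order. A Skolem circle of order $m$ is a labelling of the vertices of $C_{2m}$ by labels from $\{1,\dots,m\}$ such that each label is used exactly twice and any two vertices with the same label $s$ are at distance exactly $s$ in $C_{2m}$. An edge $e$ of $C_{2m}$ is removable if in the path $C_{2m}-e$ any two vertices with the same label $s$ are still at distance exactly $s$. A Skolem circle is $j$-edge-removable if it has $j$ removable edges (so that deleting them one at a time and reading in both directions yields $2j$ Skolem sequences). -}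

module Defs where

open import Data.Nat using (ℕ; zero; suc; _+_; _*_; _∸_; _≤_; _<_; _≤ᵇ_; _⊓_; ∣_-_∣)
open import Data.Nat.Properties using (_≟_)
open import Data.Bool using (if_then_else_)
open import Data.Fin using (Fin; toℕ)
open import Data.List using (List; length; lookup; filter; allFin)
open import Data.List.Membership.Propositional using (_∈_)
open import Data.Product using (Σ; ∃; ∃-syntax; _×_)
open import Function.Definitions using (Injective)
open import Relation.Binary.PropositionalEquality using (_≡_; _≢_)

occ : ℕ → List ℕ → ℕ
occ x s = length (filter (_≟ x) s)

IsSkolemType : List ℕ → Set
IsSkolemType s =
  ∀ x → x ∈ s →
    (1 ≤ x) × (occ x s ≡ 2) ×
    (∃[ p ] ∃[ q ] (lookup s p ≡ x) × (lookup s q ≡ x) × (toℕ q ≡ toℕ p + x))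

-- Vertices of C_{2m}: v_1,...,v_{2m} are represented by k : Fin (2 * m),
-- with k standing for v_{k+1}; v_k and v_{k+1 mod 2m} are adjacent.
-- Distance in the cycle C_{2m}.
cycleDist : (m : ℕ) → Fin (2 * m) → Fin (2 * m) → ℕ
cycleDist m p q = ∣ toℕ p - toℕ q ∣ ⊓ (2 * m ∸ ∣ toℕ p - toℕ q ∣)

Labelling : ℕ → Set
Labelling m = Fin (2 * m) → ℕ

labelCount : (m : ℕ) → Labelling m → ℕ → ℕ
labelCount m f s = length (filter (λ v → f v ≟ s) (allFin (2 * m)))

IsSkolemCircle : (m : ℕ) → Labelling m → Set
IsSkolemCircle m f =
  (∀ v → (1 ≤ f v) × (f v ≤ m)) ×
  (∀ s → 1 ≤ s → s ≤ m → labelCount m f s ≡ 2) ×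
  (∀ p q → toℕ p ≢ toℕ q → f p ≡ f q → cycleDist m p q ≡ f p)

-- Edge k : Fin (2m) joins (0-based) vertex k and vertex k+1 mod 2m.
-- Deleting it leaves the path starting at vertex k+1 (mod 2m) and ending
-- at vertex k; pathPos gives the position (0-based) of a vertex in that path.
pathPos : (m : ℕ) → Fin (2 * m) → Fin (2 * m) → ℕ
pathPos m k p =
  if suc (toℕ k) ≤ᵇ toℕ p then toℕ p ∸ suc (toℕ k)
  else toℕ p + 2 * m ∸ suc (toℕ k)

pathDist : (m : ℕ) → Fin (2 * m) → Fin (2 * m) → Fin (2 * m) → ℕ
pathDist m k p q = ∣ pathPos m k p - pathPos m k q ∣

Removable : (m : ℕ) → Labelling m → Fin (2 * m) → Set
Removable m f k =
  ∀ p q → toℕ p ≢ toℕ q → f p ≡ f q → pathDist m k p q ≡ f p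

EdgeRemovable : (j m : ℕ) → Labelling m → Set
EdgeRemovable j m f =
  Σ (Fin j → Fin (2 * m)) λ e → Injective _≡_ _≡_ e × (∀ i → Removable m f (e i))

-- entry of a list at a 0-based position (0 if out of range)
nth : List ℕ → ℕ → ℕ
nth List.[] _ = 0
nth (x List.∷ _) zero = x
nth (_ List.∷ xs) (suc n) = nth xs n

circleOf : (m : ℕ) → List ℕ → Labelling m
circleOf m L k = nth L (toℕ k)

-- In the concatenation L = S₁⋯Sⱼ the two copies of a symbol lie in the same
-- block Sᵢ, at distance equal to the symbol, since the blocks have disjoint
-- symbol sets.  Each symbol is at most m and L has length 2m, so this is also
-- the cyclic distance.  Cutting the cycle right after the last entry of a
-- block separates no pair of equal labels, and on each side of the cut a
-- vertex's position in the resulting path is its index shifted by a constant,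
-- so all distances survive: the j block boundaries are removable edges.
module Submission where

open import Defs
open import Data.Nat using (ℕ; zero; suc; _+_; _*_; _∸_; _≤_; _<_; _≤ᵇ_; _⊓_; ∣_-_∣; z≤n; s≤s)
open import Data.Nat.Properties
open import Data.Bool using (true; false)
open import Data.Fin using (Fin; toℕ; fromℕ<) renaming (zero to fz; suc to fs)
open import Data.Fin.Properties using (toℕ<n; toℕ-fromℕ<) renaming (suc-injective to fs-injective)
open import Data.Vec using (Vec; []; _∷_; lookup; toList)
open import Data.List using (List; []; _∷_; _++_; length; concat; filter; tabulate; allFin)
  renaming (lookup to lookupˡ)
open import Data.List.Properties using (filter-accept; filter-reject; filter-++; length-++)
open import Data.List.Membership.Propositional using (_∈_)
open import Data.List.Membership.Propositional.Properties using (∈-++⁻)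
open import Data.List.Relation.Binary.Disjoint.Propositional using (Disjoint)
open import Data.List.Relation.Unary.Any using (here; there)
open import Data.Product using (∃-syntax; _×_; _,_; proj₁; proj₂)
open import Data.Sum using (_⊎_; inj₁; inj₂)
open import Data.Empty using (⊥)
open import Function.Base using (_∘_)
open import Function.Bundles using (_⇔_; Equivalence)
open import Relation.Nullary using (yes; no; ¬_; contradiction)
open import Relation.Nullary.Reflects using (ofʸ; ofⁿ)
open import Relation.Binary using (tri<; tri≈; tri>)
open import Relation.Binary.PropositionalEquality

nth-∈ : ∀ (L : List ℕ) {a} → a < length L → nth L a ∈ L
nth-∈ (x ∷ L) {zero} _ = here refl
nth-∈ (x ∷ L) {suc a} (s≤s a<n) = there (nth-∈ L a<n)

nth-++ˡ : ∀ (A B : List ℕ) {a} → a < length A → nth (A ++ B) a ≡ nth A a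
nth-++ˡ (x ∷ A) B {zero} _ = refl
nth-++ˡ (x ∷ A) B {suc a} (s≤s a<n) = nth-++ˡ A B a<n

nth-++ʳ : ∀ (A B : List ℕ) b → nth (A ++ B) (length A + b) ≡ nth B b
nth-++ʳ [] B b = refl
nth-++ʳ (x ∷ A) B b = nth-++ʳ A B b

lookup≡nth : ∀ (L : List ℕ) (p : Fin (length L)) → lookupˡ L p ≡ nth L (toℕ p)
lookup≡nth (x ∷ L) fz = refl
lookup≡nth (x ∷ L) (fs p) = lookup≡nth L p

occ-∷-≡ : ∀ x L → occ x (x ∷ L) ≡ suc (occ x L)
occ-∷-≡ x L = cong length (filter-accept (_≟ x) refl)

occ-∷-≢ : ∀ {x y} L → y ≢ x → occ x (y ∷ L) ≡ occ x L
occ-∷-≢ L y≢x = cong length (filter-reject (_≟ _) y≢x)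

occ-≤-∷ : ∀ x y L → occ x L ≤ occ x (y ∷ L)
occ-≤-∷ x y L with y ≟ x
... | yes refl = subst (occ x L ≤_) (sym (occ-∷-≡ x L)) (n≤1+n _)
... | no y≢x = ≤-reflexive (sym (occ-∷-≢ L y≢x))

occ-++ : ∀ x (A B : List ℕ) → occ x (A ++ B) ≡ occ x A + occ x B
occ-++ x A B = trans (cong length (filter-++ (_≟ x) A B)) (length-++ (filter (_≟ x) A))

occ-∉ : ∀ {x} (L : List ℕ) → ¬ x ∈ L → occ x L ≡ 0
occ-∉ [] _ = refl
occ-∉ {x} (y ∷ L) x∉L with y ≟ x
... | yes refl = contradiction (here refl) x∉L
... | no y≢x = trans (occ-∷-≢ L y≢x) (occ-∉ L (x∉L ∘ there))

1≤occ : ∀ {x} L {a} → a < length L → nth L a ≡ x → 1 ≤ occ x L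
1≤occ (y ∷ L) {zero} _ refl = subst (1 ≤_) (sym (occ-∷-≡ y L)) (s≤s z≤n)
1≤occ (y ∷ L) {suc a} (s≤s a<n) La≡x = ≤-trans (1≤occ L a<n La≡x) (occ-≤-∷ _ y L)

2≤occ : ∀ {x} L {a b} → a < b → b < length L → nth L a ≡ x → nth L b ≡ x → 2 ≤ occ x L
2≤occ (y ∷ L) {zero} {suc b} _ (s≤s b<n) refl Lb≡x =
  subst (2 ≤_) (sym (occ-∷-≡ y L)) (s≤s (1≤occ L b<n Lb≡x))
2≤occ (y ∷ L) {suc a} {suc b} (s≤s a<b) (s≤s b<n) La≡x Lb≡x =
  ≤-trans (2≤occ L a<b b<n La≡x Lb≡x) (occ-≤-∷ _ y L)

3≤occ : ∀ {x} L {a b c} → a < b → b < c → c < length L →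
  nth L a ≡ x → nth L b ≡ x → nth L c ≡ x → 3 ≤ occ x L
3≤occ (y ∷ L) {zero} {suc b} {suc c} _ (s≤s b<c) (s≤s c<n) refl Lb≡x Lc≡x =
  subst (3 ≤_) (sym (occ-∷-≡ y L)) (s≤s (2≤occ L b<c c<n Lb≡x Lc≡x))
3≤occ (y ∷ L) {suc a} {suc b} {suc c} (s≤s a<b) (s≤s b<c) (s≤s c<n) La≡x Lb≡x Lc≡x =
  ≤-trans (3≤occ L a<b b<c c<n La≡x Lb≡x Lc≡x) (occ-≤-∷ _ y L)

n≡2⇒3≰n : ∀ {n} → n ≡ 2 → ¬ 3 ≤ n
n≡2⇒3≰n refl = <-irrefl refl

occ≡2⇒≡⊎≡ : ∀ {x} L {P Q c} → occ x L ≡ 2 → P < Q → Q < length L → c < length L →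
  nth L P ≡ x → nth L Q ≡ x → nth L c ≡ x → c ≡ P ⊎ c ≡ Q
occ≡2⇒≡⊎≡ L {P} {Q} {c} occ≡2 P<Q Q<n c<n LP LQ Lc with <-cmp c P | <-cmp c Q
... | tri≈ _ c≡P _ | _ = inj₁ c≡P
... | _ | tri≈ _ c≡Q _ = inj₂ c≡Q
... | tri< c<P _ _ | _ = contradiction (3≤occ L c<P P<Q Q<n Lc LP LQ) (n≡2⇒3≰n occ≡2)
... | tri> _ _ P<c | tri< c<Q _ _ = contradiction (3≤occ L P<c c<Q Q<n LP Lc LQ) (n≡2⇒3≰n occ≡2)
... | tri> _ _ P<c | tri> _ _ Q<c = contradiction (3≤occ L P<Q Q<c c<n LP LQ Lc) (n≡2⇒3≰n occ≡2)

SkolemSpaced : List ℕ → Set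
SkolemSpaced L = ∀ {a b} → a < length L → b < length L → a ≢ b →
  nth L a ≡ nth L b → ∣ a - b ∣ ≡ nth L a

IsSkolemType⇒SkolemSpaced : ∀ {L} → IsSkolemType L → SkolemSpaced L
IsSkolemType⇒SkolemSpaced {L} sk {a} {b} a<n b<n a≢b La≡Lb
  with sk (nth L a) (nth-∈ L a<n)
... | 1≤x , occ≡2 , p , q , Lp≡x , Lq≡x , q≡p+x =
  distance (at-pair a<n refl) (at-pair b<n (sym La≡Lb))
  where
  P = toℕ p
  x = nth L a
  at-pair : ∀ {c} → c < length L → nth L c ≡ x → c ≡ P ⊎ c ≡ P + x
  at-pair c<n Lc≡x = subst (λ Q → _ ≡ P ⊎ _ ≡ Q) q≡p+x
    (occ≡2⇒≡⊎≡ L occ≡2 (subst (P <_) (sym q≡p+x) (m<m+n P 1≤x)) (toℕ<n q) c<n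
      (trans (sym (lookup≡nth L p)) Lp≡x) (trans (sym (lookup≡nth L q)) Lq≡x) Lc≡x)
  distance : a ≡ P ⊎ a ≡ P + x → b ≡ P ⊎ b ≡ P + x → ∣ a - b ∣ ≡ x
  distance (inj₁ a≡P) (inj₁ b≡P) = contradiction (trans a≡P (sym b≡P)) a≢b
  distance (inj₂ a≡Q) (inj₂ b≡Q) = contradiction (trans a≡Q (sym b≡Q)) a≢b
  distance (inj₁ a≡P) (inj₂ b≡Q) = trans (cong₂ ∣_-_∣ a≡P b≡Q) (∣m-m+n∣≡n P x)
  distance (inj₂ a≡Q) (inj₁ b≡P) =
    trans (cong₂ ∣_-_∣ a≡Q b≡P) (trans (∣-∣-comm (P + x) P) (∣m-m+n∣≡n P x))

data Side (l : ℕ) : ℕ → Set where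
  before : ∀ {a} → a < l → Side l a
  after : ∀ a → Side l (l + a)

side : ∀ l a → Side l a
side l a with a <? l
... | yes a<l = before a<l
... | no a≮l = subst (Side l) (m+[n∸m]≡n (≮⇒≥ a≮l)) (after (a ∸ l))

<-length-++ʳ : ∀ (A B : List ℕ) {b} → length A + b < length (A ++ B) → b < length B
<-length-++ʳ A B {b} h =
  +-cancelˡ-< (length A) b (length B) (subst (length A + b <_) (length-++ A) h)

nth-++-disjoint : ∀ {A B : List ℕ} → Disjoint A B → ∀ {a b} → a < length A →
  length A + b < length (A ++ B) → nth (A ++ B) a ≢ nth (A ++ B) (length A + b)
nth-++-disjoint {A} {B} A∩B=∅ {a} {b} a<n b<n eq = A∩B=∅
  ( nth-∈ A a<n
  , subst (_∈ B) (trans (sym (nth-++ʳ A B b)) (trans (sym eq) (nth-++ˡ A B a<n)))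
      (nth-∈ B (<-length-++ʳ A B b<n)) )

SkolemSpaced-++ : ∀ {A B} → SkolemSpaced A → SkolemSpaced B → Disjoint A B →
  SkolemSpaced (A ++ B)
SkolemSpaced-++ {A} {B} spA spB A∩B=∅ {a} {b} a<n b<n a≢b eq
  with side (length A) a | side (length A) b
... | before a<l | before b<l =
  begin
    ∣ a - b ∣        ≡⟨ spA a<l b<l a≢b (trans (sym (nth-++ˡ A B a<l)) (trans eq (nth-++ˡ A B b<l))) ⟩
    nth A a          ≡⟨ nth-++ˡ A B a<l ⟨
    nth (A ++ B) a   ∎
  where open ≡-Reasoning
... | before a<l | after b' = contradiction eq (nth-++-disjoint A∩B=∅ a<l b<n)
... | after a' | before b<l = contradiction (sym eq) (nth-++-disjoint A∩B=∅ b<l a<n)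
... | after a' | after b' =
  begin
    ∣ length A + a' - length A + b' ∣   ≡⟨ ∣m+n-m+o∣≡∣n-o∣ (length A) a' b' ⟩
    ∣ a' - b' ∣                         ≡⟨ spB (<-length-++ʳ A B a<n) (<-length-++ʳ A B b<n)
                                               (a≢b ∘ cong (length A +_))
                                               (trans (sym (nth-++ʳ A B a')) (trans eq (nth-++ʳ A B b'))) ⟩
    nth B a'                            ≡⟨ nth-++ʳ A B a' ⟨
    nth (A ++ B) (length A + a')        ∎
  where open ≡-Reasoning

NoPairAcross : List ℕ → ℕ → Set
NoPairAcross L c = ∀ {a b} → a < c → c ≤ b → b < length L → nth L a ≢ nth L b

NoPairAcross-++ : ∀ {A B} → Disjoint A B → NoPairAcross (A ++ B) (length A)
NoPairAcross-++ {A} {B} A∩B=∅ {a} {b} a<l l≤b b<n with side (length A) b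
... | before b<l = contradiction l≤b (<⇒≱ b<l)
... | after b' = nth-++-disjoint A∩B=∅ a<l b<n

NoPairAcross-++ʳ : ∀ {A B c} → Disjoint A B → NoPairAcross B c →
  NoPairAcross (A ++ B) (length A + c)
NoPairAcross-++ʳ {A} {B} {c} A∩B=∅ noB {a} {b} a<l+c l+c≤b b<n
  with side (length A) a | side (length A) b
... | _ | before b<l = contradiction (≤-trans (m≤m+n (length A) c) l+c≤b) (<⇒≱ b<l)
... | before a<l | after b' = nth-++-disjoint A∩B=∅ a<l b<n
... | after a' | after b' = λ eq →
  noB (+-cancelˡ-< (length A) a' c a<l+c) (+-cancelˡ-≤ (length A) c b' l+c≤b) (<-length-++ʳ A B b<n)
    (trans (sym (nth-++ʳ A B a')) (trans eq (nth-++ʳ A B b')))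

flatten : ∀ {j} → Vec (List ℕ) j → List ℕ
flatten S = concat (toList S)

PairwiseDisjoint : ∀ {j} → Vec (List ℕ) j → Set
PairwiseDisjoint S = ∀ i i' → i ≢ i' → ∀ x → x ∈ lookup S i → x ∈ lookup S i' → ⊥

∈-flatten⁻ : ∀ {j} (S : Vec (List ℕ) j) {x} → x ∈ flatten S → ∃[ i ] x ∈ lookup S i
∈-flatten⁻ (s ∷ S) x∈ with ∈-++⁻ s x∈
... | inj₁ x∈s = fz , x∈s
... | inj₂ x∈S with ∈-flatten⁻ S x∈S
...   | i , x∈Si = fs i , x∈Si

PairwiseDisjoint-tail : ∀ {j s} {S : Vec (List ℕ) j} →
  PairwiseDisjoint (s ∷ S) → PairwiseDisjoint S
PairwiseDisjoint-tail disj i i' i≢i' = disj (fs i) (fs i') (i≢i' ∘ fs-injective)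

PairwiseDisjoint-head : ∀ {j s} {S : Vec (List ℕ) j} →
  PairwiseDisjoint (s ∷ S) → Disjoint s (flatten S)
PairwiseDisjoint-head {S = S} disj (x∈s , x∈S) with ∈-flatten⁻ S x∈S
... | i , x∈Si = disj fz (fs i) (λ ()) _ x∈s x∈Si

SkolemSpaced-flatten : ∀ {j} (S : Vec (List ℕ) j) → (∀ i → IsSkolemType (lookup S i)) →
  PairwiseDisjoint S → SkolemSpaced (flatten S)
SkolemSpaced-flatten [] _ _ ()
SkolemSpaced-flatten (s ∷ S) sk disj = SkolemSpaced-++ (IsSkolemType⇒SkolemSpaced (sk fz))
  (SkolemSpaced-flatten S (sk ∘ fs) (PairwiseDisjoint-tail disj)) (PairwiseDisjoint-head disj)

occ-flatten : ∀ {j} (S : Vec (List ℕ) j) → (∀ i → IsSkolemType (lookup S i)) →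
  PairwiseDisjoint S → ∀ {x} i → x ∈ lookup S i → occ x (flatten S) ≡ 2
occ-flatten (s ∷ S) sk disj {x} fz x∈s =
  trans (occ-++ x s (flatten S))
    (cong₂ _+_ (proj₁ (proj₂ (sk fz x x∈s)))
      (occ-∉ (flatten S) (λ x∈S → PairwiseDisjoint-head disj (x∈s , x∈S))))
occ-flatten (s ∷ S) sk disj {x} (fs i) x∈Si =
  trans (occ-++ x s (flatten S))
    (cong₂ _+_ (occ-∉ s (λ x∈s → disj fz (fs i) (λ ()) x x∈s x∈Si))
      (occ-flatten S (sk ∘ fs) (PairwiseDisjoint-tail disj) i x∈Si))

blockEnd : ∀ {j} → Vec (List ℕ) j → Fin j → ℕ
blockEnd (s ∷ S) fz = length s
blockEnd (s ∷ S) (fs i) = length s + blockEnd S i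

NoPairAcross-blockEnd : ∀ {j} (S : Vec (List ℕ) j) → PairwiseDisjoint S →
  ∀ i → NoPairAcross (flatten S) (blockEnd S i)
NoPairAcross-blockEnd (s ∷ S) disj fz = NoPairAcross-++ (PairwiseDisjoint-head disj)
NoPairAcross-blockEnd (s ∷ S) disj (fs i) =
  NoPairAcross-++ʳ (PairwiseDisjoint-head disj) (NoPairAcross-blockEnd S (PairwiseDisjoint-tail disj) i)

blockEnd-positive : ∀ {j} (S : Vec (List ℕ) j) → (∀ i → 0 < length (lookup S i)) →
  ∀ i → 0 < blockEnd S i
blockEnd-positive (s ∷ S) nonempty fz = nonempty fz
blockEnd-positive (s ∷ S) nonempty (fs i) =
  ≤-trans (blockEnd-positive S (nonempty ∘ fs) i) (m≤n+m (blockEnd S i) (length s))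

blockEnd≤length : ∀ {j} (S : Vec (List ℕ) j) i → blockEnd S i ≤ length (flatten S)
blockEnd≤length (s ∷ S) fz = subst (length s ≤_) (sym (length-++ s)) (m≤m+n (length s) _)
blockEnd≤length (s ∷ S) (fs i) =
  subst (length s + blockEnd S i ≤_) (sym (length-++ s))
    (+-monoʳ-≤ (length s) (blockEnd≤length S i))

blockEnd-injective : ∀ {j} (S : Vec (List ℕ) j) → (∀ i → 0 < length (lookup S i)) →
  ∀ {i i'} → blockEnd S i ≡ blockEnd S i' → i ≡ i'
blockEnd-injective (s ∷ S) nonempty {fz} {fz} _ = refl
blockEnd-injective (s ∷ S) nonempty {fz} {fs i'} eq =
  contradiction eq (<⇒≢ (m<m+n (length s) (blockEnd-positive S (nonempty ∘ fs) i')))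
blockEnd-injective (s ∷ S) nonempty {fs i} {fz} eq =
  contradiction (sym eq) (<⇒≢ (m<m+n (length s) (blockEnd-positive S (nonempty ∘ fs) i)))
blockEnd-injective (s ∷ S) nonempty {fs i} {fs i'} eq =
  cong fs (blockEnd-injective S (nonempty ∘ fs) (+-cancelˡ-≡ (length s) _ _ eq))

occUpTo : ℕ → List ℕ → ℕ
occUpTo zero L = 0
occUpTo (suc n) L = occ (suc n) L + occUpTo n L

occUpTo-∷-out : ∀ {n y} L → n < y → occUpTo n (y ∷ L) ≡ occUpTo n L
occUpTo-∷-out {zero} L _ = refl
occUpTo-∷-out {suc n} L n<y =
  cong₂ _+_ (occ-∷-≢ L (<⇒≢ n<y ∘ sym)) (occUpTo-∷-out L (<-trans (n<1+n n) n<y))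

occUpTo-∷-in : ∀ {n y} L → 1 ≤ y → y ≤ n → occUpTo n (y ∷ L) ≡ suc (occUpTo n L)
occUpTo-∷-in {zero} L () z≤n
occUpTo-∷-in {suc n} {y} L 1≤y y≤n with y ≟ suc n
... | yes refl = cong₂ _+_ (occ-∷-≡ (suc n) L) (occUpTo-∷-out L (n<1+n n))
... | no y≢n =
  trans (cong₂ _+_ (occ-∷-≢ L y≢n) (occUpTo-∷-in L 1≤y (≤-pred (≤∧≢⇒< y≤n y≢n))))
        (+-suc (occ (suc n) L) (occUpTo n L))

length≡occUpTo : ∀ n (L : List ℕ) → (∀ {y} → y ∈ L → 1 ≤ y × y ≤ n) → length L ≡ occUpTo n L
length≡occUpTo zero [] _ = refl
length≡occUpTo (suc n) [] _ = length≡occUpTo n [] (λ ())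
length≡occUpTo n (y ∷ L) range with range (here refl)
... | 1≤y , y≤n =
  sym (trans (occUpTo-∷-in L 1≤y y≤n) (cong suc (sym (length≡occUpTo n L (range ∘ there)))))

occUpTo≡2* : ∀ n (L : List ℕ) → (∀ {x} → 1 ≤ x → x ≤ n → occ x L ≡ 2) → occUpTo n L ≡ 2 * n
occUpTo≡2* zero L _ = refl
occUpTo≡2* (suc n) L twice =
  trans (cong₂ _+_ (twice (s≤s z≤n) ≤-refl)
                   (occUpTo≡2* n L (λ 1≤x x≤n → twice 1≤x (m≤n⇒m≤1+n x≤n))))
        (sym (*-distribˡ-+ 2 1 n))

occ-tabulate : ∀ (L : List ℕ) {X : Set} (t : Fin (length L) → X) (h : X → ℕ) s →
  (∀ i → h (t i) ≡ nth L (toℕ i)) → length (filter (λ v → h v ≟ s) (tabulate t)) ≡ occ s L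
occ-tabulate [] t h s ht = refl
occ-tabulate (y ∷ L) t h s ht with h (t fz) ≟ s
... | yes h≡s = trans (cong length (filter-accept (λ v → h v ≟ s) h≡s))
                  (trans (cong suc (occ-tabulate L (t ∘ fs) h s (ht ∘ fs)))
                    (sym (cong length (filter-accept (_≟ s) (trans (sym (ht fz)) h≡s)))))
... | no h≢s = trans (cong length (filter-reject (λ v → h v ≟ s) h≢s))
                 (trans (occ-tabulate L (t ∘ fs) h s (ht ∘ fs))
                   (sym (cong length (filter-reject (_≟ s) (h≢s ∘ trans (ht fz))))))

labelCount-circleOf : ∀ m (L : List ℕ) s → length L ≡ 2 * m → labelCount m (circleOf m L) s ≡ occ s L
labelCount-circleOf m L s = count (2 * m)
  where
  count : ∀ n → length L ≡ n → length (filter (λ v → nth L (toℕ v) ≟ s) (allFin n)) ≡ occ s L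
  count _ refl = occ-tabulate L (λ v → v) (λ v → nth L (toℕ v)) s (λ _ → refl)

module _ (m : ℕ) (k : Fin (2 * m)) where

  private
    K = suc (toℕ k)

  pathPos-after : ∀ {p} → K ≤ toℕ p → pathPos m k p ≡ toℕ p ∸ K
  pathPos-after {p} K≤p with K ≤ᵇ toℕ p | ≤ᵇ-reflects-≤ K (toℕ p)
  ... | true | _ = refl
  ... | false | ofⁿ K≰p = contradiction K≤p K≰p

  pathPos-before : ∀ {p} → toℕ p < K → pathPos m k p ≡ toℕ p + (2 * m ∸ K)
  pathPos-before {p} p<K with K ≤ᵇ toℕ p | ≤ᵇ-reflects-≤ K (toℕ p)
  ... | true | ofʸ K≤p = contradiction K≤p (<⇒≱ p<K)
  ... | false | _ = +-∸-assoc (toℕ p) (toℕ<n k)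

  pathDist-after : ∀ {p q} → K ≤ toℕ p → K ≤ toℕ q → pathDist m k p q ≡ ∣ toℕ p - toℕ q ∣
  pathDist-after {p} {q} K≤p K≤q = begin
    ∣ pathPos m k p - pathPos m k q ∣       ≡⟨ cong₂ ∣_-_∣ (pathPos-after K≤p) (pathPos-after K≤q) ⟩
    ∣ toℕ p ∸ K - toℕ q ∸ K ∣               ≡⟨ ∣m+n-m+o∣≡∣n-o∣ K (toℕ p ∸ K) (toℕ q ∸ K) ⟨
    ∣ K + (toℕ p ∸ K) - K + (toℕ q ∸ K) ∣   ≡⟨ cong₂ ∣_-_∣ (m+[n∸m]≡n K≤p) (m+[n∸m]≡n K≤q) ⟩
    ∣ toℕ p - toℕ q ∣                       ∎
    where open ≡-Reasoning

  pathDist-before : ∀ {p q} → toℕ p < K → toℕ q < K → pathDist m k p q ≡ ∣ toℕ p - toℕ q ∣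
  pathDist-before {p} {q} p<K q<K = begin
    ∣ pathPos m k p - pathPos m k q ∣       ≡⟨ cong₂ ∣_-_∣ (pathPos-before p<K) (pathPos-before q<K) ⟩
    ∣ toℕ p + d - toℕ q + d ∣               ≡⟨ cong₂ ∣_-_∣ (+-comm (toℕ p) d) (+-comm (toℕ q) d) ⟩
    ∣ d + toℕ p - d + toℕ q ∣               ≡⟨ ∣m+n-m+o∣≡∣n-o∣ d (toℕ p) (toℕ q) ⟩
    ∣ toℕ p - toℕ q ∣                       ∎
    where
    open ≡-Reasoning
    d = 2 * m ∸ K

n≤m⇒n≤2m∸n : ∀ {n m} → n ≤ m → n ≤ 2 * m ∸ n
n≤m⇒n≤2m∸n {n} {m} n≤m = begin
  n              ≤⟨ n≤m ⟩
  m              ≡⟨ trans (m+n∸m≡n m (m + 0)) (+-identityʳ m) ⟨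
  2 * m ∸ m      ≤⟨ ∸-monoʳ-≤ (2 * m) n≤m ⟩
  2 * m ∸ n      ∎
  where open ≤-Reasoning

module _ (m : ℕ) (L : List ℕ) (length≡2m : length L ≡ 2 * m) where

  private
    <length : (p : Fin (2 * m)) → toℕ p < length L
    <length p = subst (toℕ p <_) (sym length≡2m) (toℕ<n p)

  circleOf-∈ : ∀ v → circleOf m L v ∈ L
  circleOf-∈ v = nth-∈ L (<length v)

  module _ (spaced : SkolemSpaced L) where

    cycleDist-circleOf : (∀ {y} → y ∈ L → y ≤ m) → ∀ p q → toℕ p ≢ toℕ q →
      circleOf m L p ≡ circleOf m L q → cycleDist m p q ≡ circleOf m L p
    cycleDist-circleOf ≤m p q p≢q eq =
      trans (m≤n⇒m⊓n≡m (n≤m⇒n≤2m∸n (subst (_≤ m) (sym dist) (≤m (circleOf-∈ p))))) dist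
      where dist = spaced (<length p) (<length q) p≢q eq

    removable-at-cut : ∀ k → NoPairAcross L (suc (toℕ k)) → Removable m (circleOf m L) k
    removable-at-cut k noPair p q p≢q eq with suc (toℕ k) ≤? toℕ p | suc (toℕ k) ≤? toℕ q
    ... | yes K≤p | yes K≤q = trans (pathDist-after m k K≤p K≤q) dist
      where dist = spaced (<length p) (<length q) p≢q eq
    ... | no K≰p | no K≰q = trans (pathDist-before m k (≰⇒> K≰p) (≰⇒> K≰q)) dist
      where dist = spaced (<length p) (<length q) p≢q eq
    ... | yes K≤p | no K≰q = contradiction (sym eq) (noPair (≰⇒> K≰q) K≤p (<length p))
    ... | no K≰p | yes K≤q = contradiction eq (noPair (≰⇒> K≰p) K≤q (<length q))

pred-Fin : ∀ {n b} → 0 < b → b ≤ n → ∃[ k ] suc (toℕ {n} k) ≡ b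
pred-Fin {b = suc b} _ b<n = fromℕ< b<n , cong suc (toℕ-fromℕ< b<n)

lemma5 : (j m : ℕ) (S : Vec (List ℕ) j) →
    (∀ i → IsSkolemType (lookup S i)) →
    (∀ i → 0 < length (lookup S i)) →
    (∀ x → (∃[ i ] x ∈ lookup S i) ⇔ ((1 ≤ x) × (x ≤ m))) →
    (∀ i i' → i ≢ i' → ∀ x → x ∈ lookup S i → x ∈ lookup S i' → ⊥) →
    IsSkolemCircle m (circleOf m (concat (toList S))) ×
    EdgeRemovable j m (circleOf m (concat (toList S)))
lemma5 j m S skolem nonempty symbols disjoint =
  ( (in-range ∘ circleOf-∈ m L length≡2m)
  , (λ s 1≤s s≤m → trans (labelCount-circleOf m L s length≡2m) (twice 1≤s s≤m))
  , cycleDist-circleOf m L length≡2m spaced (proj₂ ∘ in-range) )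
  , (edge , edge-injective , removable)
  where
  L = flatten S
  in-range : ∀ {y} → y ∈ L → 1 ≤ y × y ≤ m
  in-range y∈L = Equivalence.to (symbols _) (∈-flatten⁻ S y∈L)
  twice : ∀ {x} → 1 ≤ x → x ≤ m → occ x L ≡ 2
  twice 1≤x x≤m with Equivalence.from (symbols _) (1≤x , x≤m)
  ... | i , x∈Si = occ-flatten S skolem disjoint i x∈Si
  length≡2m : length L ≡ 2 * m
  length≡2m = trans (length≡occUpTo m L in-range) (occUpTo≡2* m L twice)
  spaced : SkolemSpaced L
  spaced = SkolemSpaced-flatten S skolem disjoint
  cut : ∀ i → ∃[ k ] suc (toℕ k) ≡ blockEnd S i
  cut i = pred-Fin (blockEnd-positive S nonempty i)
                   (subst (blockEnd S i ≤_) length≡2m (blockEnd≤length S i))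
  edge : Fin j → Fin (2 * m)
  edge i = proj₁ (cut i)
  edge-injective : ∀ {i i'} → edge i ≡ edge i' → i ≡ i'
  edge-injective {i} {i'} eq =
    blockEnd-injective S nonempty
      (trans (sym (proj₂ (cut i))) (trans (cong (suc ∘ toℕ) eq) (proj₂ (cut i'))))
  removable : ∀ i → Removable m (circleOf m L) (edge i)
  removable i = removable-at-cut m L length≡2m spaced (edge i)
    (subst (NoPairAcross L) (sym (proj₂ (cut i))) (NoPairAcross-blockEnd S disjoint i))
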